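{- If $r_1\times r_2\rightleftarrows^* s\to t$, then there exist $u_1,u_2$ such that $t\rightleftarrows^* u_1\times u_2$ and either ($r_1\rightsquigarrow u_1$ and $r_2\rightleftarrows^* u_2$) or ($r_1\rightleftarrows^* u_1$ and $r_2\rightsquigarrow u_2$).
   Context: Types are generated by $A ::= \tau \mid A\Rightarrow A \mid A\wedge A$, where $\tau$ is the only atomic type ($\Rightarrow$ associates to the right). Type equivalence $\equiv$ is the smallest congruence on types such that $A\wedge B\equiv B\wedge A$, $A\wedge(B\wedge C)\equiv(A\wedge B)\wedge C$, $A\Rightarrow(B\wedge C)\equiv(A\Rightarrow B)\wedge(A\Rightarrow C)$ and $(A\wedge B)\Rightarrow C\equiv A\Rightarrow B\Rightarrow C$. To each type $A$ is associated an infinite set of variables $\mathcal V_A$, with $\mathcal V_A=\mathcal V_B$ if $A\equiv B$ and $\mathcal V_A\cap\mathcal V_B=\emptyset$ otherwise. Preterms are $r ::= x \mid \lambda x.r \mid rr \mid r\times r \mid \pi_A(r)$ (application left associative); one writes $\lambda x^A.r$ for $\lambda x.r$ when $x\in\mathcal V_A$. Introductions are abstractions and products; eliminations are applications and projections. Typing $r:A$ (without contexts): $x:A$ if $x\in\mathcal V_A$; if $r:A$ and $A\equiv B$ then $r:B$; if $r:B$ then $\lambda x^A.r:A\Rightarrow B$; if $r:A\Rightarrow B$ and $s:A$ then $rs:B$; if $r:A$ and $s:B$ then $r\times s:A\wedge B$; if $r:A\wedge B$ then $\pi_A(r):A$. Terms are well-typed preterms. $\rightleftarrows$ is the smallest symmetric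 relation, closed under all term contexts, containing $r\times s\rightleftarrows s\times r$, $(r\times s)\times t\rightleftarrows r\times(s\times t)$, $\lambda x^A.(r\times s)\rightleftarrows \lambda x^A.r\times\lambda x^A.s$, $rst\rightleftarrows r(s\times t)$; $\rightleftarrows^*$ is its reflexive transitive closure. Reduction: $\to_{\beta\pi\zeta}$: if $s:A$ then $(\lambda x^A.r)s\to_{\beta\pi\zeta} r[s/x]$; if $r:A$ then $\pi_A(r\times s)\to_{\beta\pi\zeta} r$; $(r\times s)t\to_{\beta\pi\zeta} rt\times st$. $\to_{\eta\delta}$: if $r:A\Rightarrow B$, $r$ is an elimination or a variable, and $x\in\mathcal V_A$ fresh, then $r\to_{\eta\delta}\lambda x^A.(rx)$; if $r:A\wedge B$ and $r$ is an elimination or a variable, then $r\to_{\eta\delta}\pi_A(r)\times\pi_B(r)$. The relations $\hookrightarrow$ and $\to$ are the smallest relations such that: $r\to_{\beta\pi\zeta}s$ implies $r\hookrightarrow s$; $r\to_{\eta\delta}s$ implies $r\to s$; $r\hookrightarrow s$ implies $r\to s$; $r\to s$ implies $\lambda x.r\hookrightarrow\lambda x.s$; $r\hookrightarrow s$ implies $rt\hookrightarrow st$; $r\to s$ implies $tr\hookrightarrow ts$, $r\times t\hookrightarrow s\times t$, $t\times r\hookrightarrow t\times s$; $r\hookrightarrow s$ implies $\pi_A(r)\hookrightarrow\pi_A(s)$. $r\rightsquigarrow s$ iff $r\rightleftarrows^* r'\to s'\rightleftarrows^* s$ for some $r',s'$. -}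

module Defs where

open import Data.Nat using (ℕ; zero; suc; _⊔_)
import Data.Nat.Properties as ℕP
open import Data.List using (List; []; _∷_; _++_; concatMap; filter; foldr)
open import Data.List.Membership.Propositional using (_∈_)
open import Data.Product using (_×_; _,_; ∃; ∃-syntax; Σ)
open import Data.Sum using (_⊎_)
open import Relation.Nullary using (¬_; Dec; yes; no)
open import Relation.Nullary.Decidable using (map′; ¬?)
open import Relation.Binary.PropositionalEquality using (_≡_; refl; cong; cong₂)
open import Relation.Binary.Construct.Closure.ReflexiveTransitive using (Star)
open import Data.Bool using (if_then_else_)
open import Relation.Nullary.Decidable using (⌊_⌋)

infixr 7 _⇒_
infixr 8 _∧_

data Ty : Set where
  τ   : Ty
  _⇒_ : Ty → Ty → Ty
  _∧_ : Ty → Ty → Ty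

infix 4 _≈_
data _≈_ : Ty → Ty → Set where
  ≈-refl  : ∀ {A} → A ≈ A
  ≈-sym   : ∀ {A B} → A ≈ B → B ≈ A
  ≈-trans : ∀ {A B C} → A ≈ B → B ≈ C → A ≈ C
  ≈-⇒     : ∀ {A A′ B B′} → A ≈ A′ → B ≈ B′ → (A ⇒ B) ≈ (A′ ⇒ B′)
  ≈-∧     : ∀ {A A′ B B′} → A ≈ A′ → B ≈ B′ → (A ∧ B) ≈ (A′ ∧ B′)
  ≈-comm  : ∀ {A B} → (A ∧ B) ≈ (B ∧ A)
  ≈-assoc : ∀ {A B C} → (A ∧ (B ∧ C)) ≈ ((A ∧ B) ∧ C)
  ≈-distr : ∀ {A B C} → (A ⇒ (B ∧ C)) ≈ ((A ⇒ B) ∧ (A ⇒ C))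
  ≈-curry : ∀ {A B C} → ((A ∧ B) ⇒ C) ≈ (A ⇒ B ⇒ C)

-- Variables.  A variable is a pair (A , n); it belongs to 𝒱_B iff A ≈ B.
-- Hence 𝒱_B is infinite, 𝒱_A = 𝒱_B when A ≈ B and disjoint otherwise.

record Var : Set where
  constructor v
  field
    ty  : Ty
    idx : ℕ
open Var public

_∈𝒱_ : Var → Ty → Set
x ∈𝒱 A = ty x ≈ A

_≟Ty_ : (A B : Ty) → Dec (A ≡ B)
τ ≟Ty τ = yes refl
τ ≟Ty (_ ⇒ _) = no λ ()
τ ≟Ty (_ ∧ _) = no λ ()
(_ ⇒ _) ≟Ty τ = no λ ()
(_ ⇒ _) ≟Ty (_ ∧ _) = no λ ()
(_ ∧ _) ≟Ty τ = no λ ()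
(_ ∧ _) ≟Ty (_ ⇒ _) = no λ ()
(A ⇒ B) ≟Ty (C ⇒ D) with A ≟Ty C | B ≟Ty D
... | yes refl | yes refl = yes refl
... | no p | _ = no λ { refl → p refl }
... | yes _ | no q = no λ { refl → q refl }
(A ∧ B) ≟Ty (C ∧ D) with A ≟Ty C | B ≟Ty D
... | yes refl | yes refl = yes refl
... | no p | _ = no λ { refl → p refl }
... | yes _ | no q = no λ { refl → q refl }

_≟V_ : (x y : Var) → Dec (x ≡ y)
v A n ≟V v B m with A ≟Ty B | n ℕP.≟ m
... | yes refl | yes refl = yes refl
... | no p | _ = no λ { refl → p refl }
... | yes _ | no q = no λ { refl → q refl }

infixl 9 _·_
infixr 6 _⊗_

data Tm : Set where
  var  : Var → Tm
  lam  : Var → Tm → Tm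
  _·_  : Tm → Tm → Tm
  _⊗_  : Tm → Tm → Tm
  π    : Ty → Tm → Tm

data IsElim : Tm → Set where
  app-elim  : ∀ {r s} → IsElim (r · s)
  proj-elim : ∀ {A r} → IsElim (π A r)

data ElimOrVar : Tm → Set where
  is-var  : ∀ {x} → ElimOrVar (var x)
  is-elim : ∀ {r} → IsElim r → ElimOrVar r

-- Typing (no contexts)

infix 4 _∶_
data _∶_ : Tm → Ty → Set where
  ty-var  : ∀ {x} → var x ∶ ty x
  ty-conv : ∀ {r A B} → r ∶ A → A ≈ B → r ∶ B
  ty-lam  : ∀ {x r B} → r ∶ B → lam x r ∶ (ty x ⇒ B)
  ty-app  : ∀ {r s A B} → r ∶ (A ⇒ B) → s ∶ A → r · s ∶ B
  ty-pair : ∀ {r s A B} → r ∶ A → s ∶ B → r ⊗ s ∶ (A ∧ B)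
  ty-proj : ∀ {r A B} → r ∶ (A ∧ B) → π A r ∶ A

IsTerm : Tm → Set
IsTerm r = ∃[ A ] (r ∶ A)

fv : Tm → List Var
fv (var x)   = x ∷ []
fv (lam x r) = filter (λ y → ¬? (y ≟V x)) (fv r)
fv (r · s)   = fv r ++ fv s
fv (r ⊗ s)   = fv r ++ fv s
fv (π A r)   = fv r

maxIdx : List Var → ℕ
maxIdx = foldr (λ x n → idx x ⊔ n) 0

fresh : Ty → List Var → Var
fresh A xs = v A (suc (maxIdx xs))

_[_↦_] : (Var → Tm) → Var → Tm → (Var → Tm)
(σ [ x ↦ t ]) y = if ⌊ y ≟V x ⌋ then t else σ y

-- simultaneous capture-avoiding substitution (binders are renamed to
-- fresh variables of the same type; terms are meant up to α)
subst : (Var → Tm) → Tm → Tm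
subst σ (var x)   = σ x
subst σ (lam y r) =
  let z = fresh (ty y) (concatMap (λ w → fv (σ w)) (fv (lam y r)))
  in lam z (subst (σ [ y ↦ var z ]) r)
subst σ (r · s)   = subst σ r · subst σ s
subst σ (r ⊗ s)   = subst σ r ⊗ subst σ s
subst σ (π A r)   = π A (subst σ r)

_[_/_] : Tm → Tm → Var → Tm
r [ s / x ] = subst (var [ x ↦ s ]) r

-- Equivalence ⇄ (with α-conversion, since terms are taken up to α)

data _⇄₀_ : Tm → Tm → Set where
  comm   : ∀ {r s} → (r ⊗ s) ⇄₀ (s ⊗ r)
  assoc  : ∀ {r s t} → ((r ⊗ s) ⊗ t) ⇄₀ (r ⊗ (s ⊗ t))
  distλ  : ∀ {x r s} → lam x (r ⊗ s) ⇄₀ (lam x r ⊗ lam x s)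
  curry  : ∀ {r s t} → (r · s · t) ⇄₀ (r · (s ⊗ t))
  α      : ∀ {x y r} → ty y ≈ ty x → ¬ (y ∈ fv (lam x r))
         → lam x r ⇄₀ lam y (r [ var y / x ])

infix 4 _⇄_ _⇄*_
data _⇄_ : Tm → Tm → Set where
  base  : ∀ {r s} → r ⇄₀ s → r ⇄ s
  sym   : ∀ {r s} → r ⇄ s → s ⇄ r
  c-lam : ∀ {x r s} → r ⇄ s → lam x r ⇄ lam x s
  c-appˡ : ∀ {r s t} → r ⇄ s → r · t ⇄ s · t
  c-appʳ : ∀ {r s t} → r ⇄ s → t · r ⇄ t · s
  c-pairˡ : ∀ {r s t} → r ⇄ s → r ⊗ t ⇄ s ⊗ t
  c-pairʳ : ∀ {r s t} → r ⇄ s → t ⊗ r ⇄ t ⊗ s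
  c-proj : ∀ {A r s} → r ⇄ s → π A r ⇄ π A s

_⇄*_ : Tm → Tm → Set
_⇄*_ = Star _⇄_

data _⟶βπζ_ : Tm → Tm → Set where
  β : ∀ {x r s} → s ∶ ty x → (lam x r · s) ⟶βπζ (r [ s / x ])
  πr : ∀ {A r s} → r ∶ A → π A (r ⊗ s) ⟶βπζ r
  ζ : ∀ {r s t} → ((r ⊗ s) · t) ⟶βπζ ((r · t) ⊗ (s · t))

data _⟶ηδ_ : Tm → Tm → Set where
  η : ∀ {r A B x} → r ∶ (A ⇒ B) → ElimOrVar r → x ∈𝒱 A → ¬ (x ∈ fv r)
    → r ⟶ηδ lam x (r · var x)
  δ : ∀ {r A B} → r ∶ (A ∧ B) → ElimOrVar r
    → r ⟶ηδ (π A r ⊗ π B r)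

infix 4 _↪_ _⟶_ _⇝_
data _↪_ : Tm → Tm → Set
data _⟶_ : Tm → Tm → Set

data _↪_ where
  ↪-βπζ  : ∀ {r s} → r ⟶βπζ s → r ↪ s
  ↪-lam  : ∀ {x r s} → r ⟶ s → lam x r ↪ lam x s
  ↪-appˡ : ∀ {r s t} → r ↪ s → r · t ↪ s · t
  ↪-appʳ : ∀ {r s t} → r ⟶ s → t · r ↪ t · s
  ↪-pairˡ : ∀ {r s t} → r ⟶ s → r ⊗ t ↪ s ⊗ t
  ↪-pairʳ : ∀ {r s t} → r ⟶ s → t ⊗ r ↪ t ⊗ s
  ↪-proj : ∀ {A r s} → r ↪ s → π A r ↪ π A s

data _⟶_ where
  ⟶-ηδ : ∀ {r s} → r ⟶ηδ s → r ⟶ s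
  ⟶-↪  : ∀ {r s} → r ↪ s → r ⟶ s

_⇝_ : Tm → Tm → Set
r ⇝ s = ∃[ r′ ] ∃[ s′ ] (r ⇄* r′ × r′ ⟶ s′ × s′ ⇄* s)

-- Distributing abstractions over products and flattening products sends
-- every term r to a nonempty list of product-free components, and r is
-- ⇄*-equivalent to their right-nested product.  Two facts carry the proof:
--   (1) ⇄ only permutes components, up to ⇄* on each component
--       (components-resp-⇄*);
--   (2) a reduction step s ⟶ t is a ⇝-step of exactly one component of s, t
--       being the product of the reduct and the untouched components
--       (step-componentStep).
-- The components of r₁ ⊗ r₂ are those of r₁ followed by those of r₂, so the
-- reducing component comes from r₁ or from r₂, and regrouping the product gives
-- the two alternatives of the theorem.  The only delicate case of (1) is
-- α-conversion, which renames the bound variable inside every component; it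
-- needs that substitution commutes with composition of renamings up to α
-- (subst-∘ₛ), developed first from basic facts about free variables.

module Submission where

open import Defs
open import Function using (_∘_)
open import Data.Product using (_×_; _,_; ∃-syntax)
open import Data.Sum using (_⊎_; inj₁; inj₂)
open import Data.Nat using (_≤_)
import Data.Nat.Properties as ℕ
open import Data.List using (List; []; _∷_; _++_; concat; concatMap)
import Data.List as List
import Data.List.Properties as List
open import Data.List.Membership.Propositional using (_∈_; _∉_)
open import Data.List.Membership.Propositional.Properties
  using (∈-++⁺ˡ; ∈-++⁺ʳ; ∈-++⁻; ∈-filter⁺; ∈-filter⁻; ∈-map⁺; ∈-concat⁺′)
open import Data.List.Relation.Unary.Any using (Any; here; there)
import Data.List.Relation.Unary.Any.Properties as Any
open import Data.List.NonEmpty as List⁺ using (List⁺; _∷_; [_]; toList; _⁺++⁺_)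
open import Data.List.Relation.Binary.Subset.Propositional using (_⊆_)
open import Data.List.Relation.Binary.Pointwise as Pointwise using (Pointwise; []; _∷_)
open import Relation.Binary.Bundles using (Setoid)
import Data.List.Relation.Unary.All as All
open import Data.Empty using (⊥-elim)
open import Relation.Nullary using (yes; no)
open import Relation.Nullary.Decidable using (¬?)
open import Relation.Binary.PropositionalEquality
  using (_≡_; _≢_; refl; cong; cong₂)
  renaming (sym to ≡-sym)
open import Relation.Binary.Construct.Closure.ReflexiveTransitive
  using (ε; _◅_; _◅◅_; gmap; reverse)

⇄*-sym : ∀ {r s} → r ⇄* s → s ⇄* r
⇄*-sym = reverse sym

≡⇒⇄* : ∀ {r s} → r ≡ s → r ⇄* s
≡⇒⇄* refl = ε

⇄*-lam : ∀ {x r s} → r ⇄* s → lam x r ⇄* lam x s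
⇄*-lam = gmap _ c-lam

⇄*-app : ∀ {r r′ s s′} → r ⇄* r′ → s ⇄* s′ → r · s ⇄* r′ · s′
⇄*-app p q = gmap _ c-appˡ p ◅◅ gmap _ c-appʳ q

⇄*-pair : ∀ {r r′ s s′} → r ⇄* r′ → s ⇄* s′ → r ⊗ s ⇄* r′ ⊗ s′
⇄*-pair p q = gmap _ c-pairˡ p ◅◅ gmap _ c-pairʳ q

⇄*-proj : ∀ {A r s} → r ⇄* s → π A r ⇄* π A s
⇄*-proj = gmap _ c-proj

idx≤maxIdx : ∀ {x xs} → x ∈ xs → idx x ≤ maxIdx xs
idx≤maxIdx {x} {_ ∷ ys} (here refl) = ℕ.m≤m⊔n (idx x) (maxIdx ys)
idx≤maxIdx {_} {y ∷ _}  (there p)   = ℕ.≤-trans (idx≤maxIdx p) (ℕ.m≤n⊔m (idx y) _)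

fresh-∉ : ∀ A xs → fresh A xs ∉ xs
fresh-∉ A xs p = ℕ.<-irrefl refl (idx≤maxIdx p)

update-hit : ∀ (σ : Var → Tm) x t → (σ [ x ↦ t ]) x ≡ t
update-hit σ x t with x ≟V x
... | yes _   = refl
... | no x≢x  = ⊥-elim (x≢x refl)

update-miss : ∀ (σ : Var → Tm) x t {w} → w ≢ x → (σ [ x ↦ t ]) w ≡ σ w
update-miss σ x t {w} w≢x with w ≟V x
... | yes w≡x = ⊥-elim (w≢x w≡x)
... | no _    = refl

fv-lam⁺ : ∀ {y x r} → y ∈ fv r → y ≢ x → y ∈ fv (lam x r)
fv-lam⁺ {x = x} = ∈-filter⁺ (λ z → ¬? (z ≟V x))

fv-lam⁻ : ∀ {y x r} → y ∈ fv (lam x r) → y ∈ fv r × y ≢ x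
fv-lam⁻ {x = x} = ∈-filter⁻ (λ z → ¬? (z ≟V x))

Fresh : (Var → Tm) → Tm → Var → Set
Fresh σ t z = ∀ {w} → w ∈ fv t → z ∉ fv (σ w)

binder : (Var → Tm) → Var → Tm → Var
binder σ y r = fresh (ty y) (concatMap (fv ∘ σ) (fv (lam y r)))

binder-fresh : ∀ σ y r → Fresh σ (lam y r) (binder σ y r)
binder-fresh σ y r w∈ z∈ =
  fresh-∉ (ty y) _ (∈-concat⁺′ z∈ (∈-map⁺ (fv ∘ σ) w∈))

fv-subst⁻ : ∀ σ r {y} → y ∈ fv (subst σ r) → ∃[ w ] (w ∈ fv r × y ∈ fv (σ w))
fv-subst-lam⁻ : ∀ σ z c z′ {y} → y ∈ fv (lam z′ (subst (σ [ z ↦ var z′ ]) c))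
              → ∃[ w ] (w ∈ fv (lam z c) × y ∈ fv (σ w))

fv-subst⁻ σ (var x)   p = x , here refl , p
fv-subst⁻ σ (lam z c) p = fv-subst-lam⁻ σ z c (binder σ z c) p
fv-subst⁻ σ (r · s)   p with ∈-++⁻ (fv (subst σ r)) p
... | inj₁ q = let w , w∈ , y∈ = fv-subst⁻ σ r q in w , ∈-++⁺ˡ w∈ , y∈
... | inj₂ q = let w , w∈ , y∈ = fv-subst⁻ σ s q in w , ∈-++⁺ʳ (fv r) w∈ , y∈
fv-subst⁻ σ (r ⊗ s)   p with ∈-++⁻ (fv (subst σ r)) p
... | inj₁ q = let w , w∈ , y∈ = fv-subst⁻ σ r q in w , ∈-++⁺ˡ w∈ , y∈
... | inj₂ q = let w , w∈ , y∈ = fv-subst⁻ σ s q in w , ∈-++⁺ʳ (fv r) w∈ , y∈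
fv-subst⁻ σ (π A r)   p = fv-subst⁻ σ r p

fv-subst-lam⁻ σ z c z′ p with fv-lam⁻ {r = subst (σ [ z ↦ var z′ ]) c} p
... | q , y≢z′ with fv-subst⁻ (σ [ z ↦ var z′ ]) c q
... | w , w∈c , y∈ with w ≟V z
...   | yes refl with y∈
...     | here y≡z′ = ⊥-elim (y≢z′ y≡z′)
fv-subst-lam⁻ σ z c z′ p | q , y≢z′ | w , w∈c , y∈ | no w≢z =
  w , fv-lam⁺ {r = c} w∈c w≢z , y∈

fv-subst⁺ : ∀ σ r {w y} → w ∈ fv r → y ∈ fv (σ w) → y ∈ fv (subst σ r)
fv-subst⁺ σ (var x)   (here refl) q = q
fv-subst⁺ σ (lam x r) {w} {y} p q with fv-lam⁻ {r = r} p
... | w∈r , w≢x = fv-lam⁺ {r = subst σ′ r} (fv-subst⁺ σ′ r w∈r q′) y≢z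
  where
  z = binder σ x r
  σ′ = σ [ x ↦ var z ]
  q′ : y ∈ fv (σ′ w)
  q′ rewrite update-miss σ x (var z) w≢x = q
  y≢z : y ≢ z
  y≢z refl = binder-fresh σ x r p q
fv-subst⁺ σ (r · s) p q with ∈-++⁻ (fv r) p
... | inj₁ a = ∈-++⁺ˡ (fv-subst⁺ σ r a q)
... | inj₂ a = ∈-++⁺ʳ (fv (subst σ r)) (fv-subst⁺ σ s a q)
fv-subst⁺ σ (r ⊗ s) p q with ∈-++⁻ (fv r) p
... | inj₁ a = ∈-++⁺ˡ (fv-subst⁺ σ r a q)
... | inj₂ a = ∈-++⁺ʳ (fv (subst σ r)) (fv-subst⁺ σ s a q)
fv-subst⁺ σ (π A r) p q = fv-subst⁺ σ r p q

subst-ext : ∀ σ σ′ r → (∀ {w} → w ∈ fv r → σ w ≡ σ′ w) → subst σ r ≡ subst σ′ r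
subst-ext σ σ′ (var x)   h = h (here refl)
subst-ext σ σ′ (lam x r) h =
  cong₂ lam same-binder (subst-ext (σ [ x ↦ var z ]) (σ′ [ x ↦ var z′ ]) r agree)
  where
  z = binder σ x r
  z′ = binder σ′ x r
  same-binder : z ≡ z′
  same-binder = cong (fresh (ty x) ∘ concat)
    (List.map-cong-local (All.tabulate (λ w∈ → cong fv (h w∈))))
  agree : ∀ {w} → w ∈ fv r → (σ [ x ↦ var z ]) w ≡ (σ′ [ x ↦ var z′ ]) w
  agree {w} w∈ with w ≟V x
  ... | yes refl = cong var same-binder
  ... | no w≢x   = h (fv-lam⁺ {r = r} w∈ w≢x)
subst-ext σ σ′ (r · s) h =
  cong₂ _·_ (subst-ext σ σ′ r (h ∘ ∈-++⁺ˡ)) (subst-ext σ σ′ s (h ∘ ∈-++⁺ʳ (fv r)))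
subst-ext σ σ′ (r ⊗ s) h =
  cong₂ _⊗_ (subst-ext σ σ′ r (h ∘ ∈-++⁺ˡ)) (subst-ext σ σ′ s (h ∘ ∈-++⁺ʳ (fv r)))
subst-ext σ σ′ (π A r) h = cong (π A) (subst-ext σ σ′ r h)

IsRenaming : (Var → Tm) → Set
IsRenaming σ = ∀ w → ∃[ u ] (σ w ≡ var u)

renaming-var : IsRenaming var
renaming-var w = w , refl

renaming-update : ∀ {σ} x y → IsRenaming σ → IsRenaming (σ [ x ↦ var y ])
renaming-update x y ren w with w ≟V x
... | yes _ = y , refl
... | no _  = ren w

infixr 9 _∘ₛ_
_∘ₛ_ : (Var → Tm) → (Var → Tm) → (Var → Tm)
(σ₂ ∘ₛ σ₁) w = subst σ₂ (σ₁ w)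

renaming-∘ₛ : ∀ {σ₁ σ₂} → IsRenaming σ₁ → IsRenaming σ₂ → IsRenaming (σ₂ ∘ₛ σ₁)
renaming-∘ₛ {σ₁} {σ₂} ren₁ ren₂ w with σ₁ w | ren₁ w
... | _ | u , refl = ren₂ u

fresh-∘ₛ : ∀ σ₁ σ₂ t {z} → Fresh σ₂ (subst σ₁ t) z → Fresh (σ₂ ∘ₛ σ₁) t z
fresh-∘ₛ σ₁ σ₂ t fr {w} w∈ z∈ =
  let u , u∈ , z∈′ = fv-subst⁻ σ₂ (σ₁ w) z∈ in fr (fv-subst⁺ σ₁ t w∈ u∈) z∈′

∘ₛ-update : ∀ σ₁ σ₂ z z₁ z₂ w → (w ≢ z → z₁ ∉ fv (σ₁ w))
  → ((σ₂ [ z₁ ↦ var z₂ ]) ∘ₛ (σ₁ [ z ↦ var z₁ ])) w ≡ ((σ₂ ∘ₛ σ₁) [ z ↦ var z₂ ]) w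
∘ₛ-update σ₁ σ₂ z z₁ z₂ w fr with w ≟V z
... | yes refl = update-hit σ₂ z₁ (var z₂)
... | no w≢z   = subst-ext _ _ (σ₁ w)
                   (λ u∈ → update-miss σ₂ z₁ (var z₂) λ { refl → fr w≢z u∈ })

update-unused : ∀ {κ} → IsRenaming κ → ∀ {z} t w → z ∉ fv (κ w)
  → subst (var [ z ↦ t ]) (κ w) ≡ κ w
update-unused {κ} ren t w z∉ with κ w | ren w
... | _ | u , refl = update-miss var _ t λ { refl → z∉ (here refl) }

subst-∘ₛ : ∀ r σ₁ σ₂ → IsRenaming σ₁ → IsRenaming σ₂
  → subst σ₂ (subst σ₁ r) ⇄* subst (σ₂ ∘ₛ σ₁) r

subst-lam-α : ∀ κ z c z′ → IsRenaming κ → ty z′ ≈ ty z → Fresh κ (lam z c) z′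
  → lam z′ (subst (κ [ z ↦ var z′ ]) c) ⇄* subst κ (lam z c)

subst-∘ₛ (var x)   σ₁ σ₂ ren₁ ren₂ = ε
subst-∘ₛ (r · s)   σ₁ σ₂ ren₁ ren₂ = ⇄*-app (subst-∘ₛ r σ₁ σ₂ ren₁ ren₂) (subst-∘ₛ s σ₁ σ₂ ren₁ ren₂)
subst-∘ₛ (r ⊗ s)   σ₁ σ₂ ren₁ ren₂ = ⇄*-pair (subst-∘ₛ r σ₁ σ₂ ren₁ ren₂) (subst-∘ₛ s σ₁ σ₂ ren₁ ren₂)
subst-∘ₛ (π A r)   σ₁ σ₂ ren₁ ren₂ = ⇄*-proj (subst-∘ₛ r σ₁ σ₂ ren₁ ren₂)
subst-∘ₛ (lam z c) σ₁ σ₂ ren₁ ren₂ =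
  ⇄*-lam (subst-∘ₛ c σ₁′ σ₂′ (renaming-update z z₁ ren₁) (renaming-update z₁ z₂ ren₂))
  ◅◅ ≡⇒⇄* (cong (lam z₂) (subst-ext _ _ c composed-update))
  ◅◅ subst-lam-α (σ₂ ∘ₛ σ₁) z c z₂ (renaming-∘ₛ ren₁ ren₂) ≈-refl
       (fresh-∘ₛ σ₁ σ₂ (lam z c) (binder-fresh σ₂ z₁ (subst σ₁′ c)))
  where
  z₁ = binder σ₁ z c
  σ₁′ = σ₁ [ z ↦ var z₁ ]
  z₂ = binder σ₂ z₁ (subst σ₁′ c)
  σ₂′ = σ₂ [ z₁ ↦ var z₂ ]
  composed-update : ∀ {w} → w ∈ fv c → (σ₂′ ∘ₛ σ₁′) w ≡ ((σ₂ ∘ₛ σ₁) [ z ↦ var z₂ ]) w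
  composed-update {w} w∈ =
    ∘ₛ-update σ₁ σ₂ z z₁ z₂ w (λ w≢z → binder-fresh σ₁ z c (fv-lam⁺ {r = c} w∈ w≢z))

-- Proof: α-rename z′ to the chosen binder z₃, then fuse the two renamings.
subst-lam-α κ z c z′ ren z′∶z fr =
  base (α (≈-sym z′∶z) z₃-unused)
  ◅ ⇄*-lam (subst-∘ₛ c κ′ ρ (renaming-update z z′ ren) (renaming-update z′ z₃ renaming-var)
            ◅◅ ≡⇒⇄* (subst-ext _ _ c renamed))
  where
  z₃ = binder κ z c
  κ′ = κ [ z ↦ var z′ ]
  ρ = var [ z′ ↦ var z₃ ]
  z₃-unused : z₃ ∉ fv (lam z′ (subst κ′ c))
  z₃-unused z₃∈ = let _ , w∈ , z₃∈′ = fv-subst-lam⁻ κ z c z′ z₃∈ in binder-fresh κ z c w∈ z₃∈′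
  renamed : ∀ {w} → w ∈ fv c → (ρ ∘ₛ κ′) w ≡ (κ [ z ↦ var z₃ ]) w
  renamed {w} w∈ with w ≟V z
  ... | yes refl = update-hit var z′ (var z₃)
  ... | no w≢z   = update-unused ren (var z₃) w (fr (fv-lam⁺ {r = c} w∈ w≢z))

components : Tm → List⁺ Tm
components (var x)   = [ var x ]
components (lam x b) = List⁺.map (lam x) (components b)
components (r · s)   = [ r · s ]
components (r ⊗ s)   = components r ⁺++⁺ components s
components (π A r)   = [ π A r ]

⇄*-setoid : Setoid _ _
⇄*-setoid = record
  { Carrier = Tm ; _≈_ = _⇄*_
  ; isEquivalence = record { refl = ε ; sym = ⇄*-sym ; trans = _◅◅_ } }

open import Data.List.Relation.Binary.Permutation.Setoid ⇄*-setoid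
  using (_↭_; ↭-refl; ↭-sym; ↭-trans; ↭-reflexive; ↭-prep; ↭-swap; refl; prep; swap; trans)
open import Data.List.Relation.Binary.Permutation.Setoid.Properties ⇄*-setoid
  using (++⁺ˡ; ++⁺ʳ; ++-comm; drop-∷; ∈-resp-↭; ¬x∷xs↭[])
import Data.List.Relation.Binary.Permutation.Setoid.Properties as Perm

RenamedComponent : (Var → Tm) → Tm → Tm → Tm → Set
RenamedComponent σ r d c = d ⇄* subst σ c × fv c ⊆ fv r

components-subst : ∀ {σ} → IsRenaming σ → ∀ r →
  Pointwise (RenamedComponent σ r) (toList (components (subst σ r))) (toList (components r))
components-subst {σ} ren (var x) with ren x
... | u , σx≡u rewrite σx≡u = (≡⇒⇄* (≡-sym σx≡u) , λ x∈ → x∈) ∷ []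
components-subst ren (r · s) = (ε , λ y∈ → y∈) ∷ []
components-subst ren (π A r) = (ε , λ y∈ → y∈) ∷ []
components-subst ren (r ⊗ s) =
  Pointwise.++⁺ (Pointwise.map (λ (e , c⊆) → e , λ y∈ → ∈-++⁺ˡ (c⊆ y∈)) (components-subst ren r))
                (Pointwise.map (λ (e , c⊆) → e , λ y∈ → ∈-++⁺ʳ (fv r) (c⊆ y∈)) (components-subst ren s))
components-subst {σ} ren (lam z b) =
  Pointwise.map⁺ (lam z′) (lam z)
    (Pointwise.map (λ {d} {c} → under-binder {d} {c}) (components-subst (renaming-update z z′ ren) b))
  where
  z′ = binder σ z b
  under-binder : ∀ {d c} → RenamedComponent (σ [ z ↦ var z′ ]) b d c
               → RenamedComponent σ (lam z b) (lam z′ d) (lam z c)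
  under-binder {d} {c} (d⇄ , c⊆b) =
    ⇄*-lam d⇄ ◅◅ subst-lam-α σ z c z′ ren ≈-refl (λ w∈ → binder-fresh σ z b (lam-⊆ w∈)) , lam-⊆
    where
    lam-⊆ : fv (lam z c) ⊆ fv (lam z b)
    lam-⊆ y∈ = let y∈c , y≢z = fv-lam⁻ {r = c} y∈ in fv-lam⁺ {r = b} (c⊆b y∈c) y≢z

↭-singleton : ∀ {r s} → r ⇄ s → (r ∷ []) ↭ (s ∷ [])
↭-singleton r⇄s = prep (r⇄s ◅ ε) ↭-refl

components-resp-α : ∀ {x y r} → ty y ≈ ty x → y ∉ fv (lam x r)
  → toList (components (lam x r)) ↭ toList (components (lam y (r [ var y / x ])))
components-resp-α {x} {y} {r} y∶x y∉ =
  ↭-sym (refl (Pointwise.map⁺ (lam y) (lam x)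
    (Pointwise.map (λ {d} {c} → back {d} {c})
      (components-subst (renaming-update x y renaming-var) r))))
  where
  back : ∀ {d c} → RenamedComponent (var [ x ↦ var y ]) r d c → lam y d ⇄* lam x c
  back {d} {c} (d⇄ , c⊆r) = ⇄*-lam d⇄ ◅◅ (sym (base (α y∶x y∉c)) ◅ ε)
    where
    y∉c : y ∉ fv (lam x c)
    y∉c y∈ = let y∈c , y≢x = fv-lam⁻ {r = c} y∈ in y∉ (fv-lam⁺ {r = r} (c⊆r y∈c) y≢x)

components-resp-⇄₀ : ∀ {r s} → r ⇄₀ s → toList (components r) ↭ toList (components s)
components-resp-⇄₀ (comm {r} {s})       = ++-comm (toList (components r)) (toList (components s))
components-resp-⇄₀ (assoc {r} {s} {t})  =
  ↭-reflexive (List.++-assoc (toList (components r)) (toList (components s)) (toList (components t)))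
components-resp-⇄₀ (distλ {x} {r} {s})  =
  ↭-reflexive (List.map-++ (lam x) (toList (components r)) (toList (components s)))
components-resp-⇄₀ curry                = ↭-singleton (base curry)
components-resp-⇄₀ (α {r = r} y∶x y∉)   = components-resp-α {r = r} y∶x y∉

components-resp-⇄ : ∀ {r s} → r ⇄ s → toList (components r) ↭ toList (components s)
components-resp-⇄ (base p)               = components-resp-⇄₀ p
components-resp-⇄ (sym p)                = ↭-sym (components-resp-⇄ p)
components-resp-⇄ (c-lam p)              = Perm.map⁺ ⇄*-setoid ⇄*-setoid ⇄*-lam (components-resp-⇄ p)
components-resp-⇄ (c-appˡ p)             = ↭-singleton (c-appˡ p)
components-resp-⇄ (c-appʳ p)             = ↭-singleton (c-appʳ p)
components-resp-⇄ (c-pairˡ {t = t} p)    = ++⁺ʳ (toList (components t)) (components-resp-⇄ p)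
components-resp-⇄ (c-pairʳ {t = t} p)    = ++⁺ˡ (toList (components t)) (components-resp-⇄ p)
components-resp-⇄ (c-proj p)             = ↭-singleton (c-proj p)

components-resp-⇄* : ∀ {r s} → r ⇄* s → toList (components r) ↭ toList (components s)
components-resp-⇄* ε       = ↭-refl
components-resp-⇄* (p ◅ q) = ↭-trans (components-resp-⇄ p) (components-resp-⇄* q)

infixr 5 _⊗⋯_
_⊗⋯_ : Tm → List Tm → Tm
c ⊗⋯ []     = c
c ⊗⋯ d ∷ ds = c ⊗ (d ⊗⋯ ds)

⨂ : List⁺ Tm → Tm
⨂ (c ∷ cs) = c ⊗⋯ cs

⊗⋯-pointwise : ∀ {c d L M} → Pointwise _⇄*_ (c ∷ L) (d ∷ M) → c ⊗⋯ L ⇄* d ⊗⋯ M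
⊗⋯-pointwise (e ∷ [])      = e
⊗⋯-pointwise (e ∷ e′ ∷ es) = ⇄*-pair e (⊗⋯-pointwise (e′ ∷ es))

⊗-exchange : ∀ {r s t} → r ⊗ (s ⊗ t) ⇄* s ⊗ (r ⊗ t)
⊗-exchange = sym (base assoc) ◅ c-pairˡ (base comm) ◅ base assoc ◅ ε

⊗⋯-↭ : ∀ {c d L M} → (c ∷ L) ↭ (d ∷ M) → c ⊗⋯ L ⇄* d ⊗⋯ M
⊗⋯-↭ (refl es) = ⊗⋯-pointwise es
⊗⋯-↭ {L = []}    {M = []}    (prep e _) = e
⊗⋯-↭ {L = _ ∷ _} {M = _ ∷ _} (prep e p) = ⇄*-pair e (⊗⋯-↭ p)
⊗⋯-↭ {L = []}    {M = _ ∷ _} (prep _ p) = ⊥-elim (¬x∷xs↭[] (↭-sym p))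
⊗⋯-↭ {L = _ ∷ _} {M = []}    (prep _ p) = ⊥-elim (¬x∷xs↭[] p)
⊗⋯-↭ {L = _ ∷ []}    {M = _ ∷ []}    (swap e₁ e₂ _) = base comm ◅ ⇄*-pair e₂ e₁
⊗⋯-↭ {L = _ ∷ _ ∷ _} {M = _ ∷ _ ∷ _} (swap e₁ e₂ p) = ⊗-exchange ◅◅ ⇄*-pair e₂ (⇄*-pair e₁ (⊗⋯-↭ p))
⊗⋯-↭ {L = _ ∷ []}    {M = _ ∷ _ ∷ _} (swap _ _ p) = ⊥-elim (¬x∷xs↭[] (↭-sym p))
⊗⋯-↭ {L = _ ∷ _ ∷ _} {M = _ ∷ []}    (swap _ _ p) = ⊥-elim (¬x∷xs↭[] p)
⊗⋯-↭ (trans {ys = []}    p _) = ⊥-elim (¬x∷xs↭[] p)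
⊗⋯-↭ (trans {ys = _ ∷ _} p q) = ⊗⋯-↭ p ◅◅ ⊗⋯-↭ q

⊗⋯-++ : ∀ c L Y → c ⊗⋯ (L ++ toList Y) ⇄* (c ⊗⋯ L) ⊗ ⨂ Y
⊗⋯-++ c []      Y = ε
⊗⋯-++ c (d ∷ L) Y = ⇄*-pair ε (⊗⋯-++ d L Y) ◅◅ (sym (base assoc) ◅ ε)

⨂-⁺++⁺ : ∀ X Y → ⨂ (X ⁺++⁺ Y) ⇄* ⨂ X ⊗ ⨂ Y
⨂-⁺++⁺ (c ∷ L) Y = ⊗⋯-++ c L Y

⊗⋯-lam : ∀ x c L → lam x (c ⊗⋯ L) ⇄* lam x c ⊗⋯ List.map (lam x) L
⊗⋯-lam x c []      = ε
⊗⋯-lam x c (d ∷ L) = base distλ ◅ ⇄*-pair ε (⊗⋯-lam x d L)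

⨂-components : ∀ r → r ⇄* ⨂ (components r)
⨂-components (var x)   = ε
⨂-components (lam x b) = ⇄*-lam (⨂-components b) ◅◅ ⊗⋯-lam x _ _
⨂-components (r · s)   = ε
⨂-components (r ⊗ s)   =
  ⇄*-pair (⨂-components r) (⨂-components s) ◅◅ ⇄*-sym (⨂-⁺++⁺ (components r) (components s))
⨂-components (π A r)   = ε

⊗⋯-step : ∀ {c c′} L → c ⟶ c′ → c ⊗⋯ L ⟶ c′ ⊗⋯ L
⊗⋯-step []      step = step
⊗⋯-step (_ ∷ _) step = ⟶-↪ (↪-pairˡ step)

⊗⋯-head : ∀ {c c′} L → c ⇄* c′ → c ⊗⋯ L ⇄* c′ ⊗⋯ L
⊗⋯-head L e = ⊗⋯-↭ (prep e ↭-refl)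

record ComponentStep (s t : Tm) : Set where
  constructor componentStep
  field
    {c c′}   : Tm
    {rest}   : List Tm
    split    : toList (components s) ↭ c ∷ rest
    reduces  : c ⇝ c′
    result   : t ⇄* c′ ⊗⋯ rest

componentStep-resp : ∀ {s s₀ t t₀} → s ⇄* s₀ → t ⇄* t₀ → ComponentStep s₀ t₀ → ComponentStep s t
componentStep-resp s⇄ t⇄ (componentStep split reduces result) =
  componentStep (↭-trans (components-resp-⇄* s⇄) split) reduces (t⇄ ◅◅ result)

componentStep-occurs : ∀ {s t} (step : ComponentStep s t)
  → Any (ComponentStep.c step ⇄*_) (toList (components s))
componentStep-occurs step = ∈-resp-↭ (↭-sym (ComponentStep.split step)) (here ε)

⇝-lam : ∀ {x c c′} → c ⇝ c′ → lam x c ⇝ lam x c′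
⇝-lam (c₀ , c₁ , c⇄ , step , ⇄c′) = lam _ c₀ , lam _ c₁ , ⇄*-lam c⇄ , ⟶-↪ (↪-lam step) , ⇄*-lam ⇄c′

componentStep-⊗ˡ : ∀ {a a′ b} → ComponentStep a a′ → ComponentStep (a ⊗ b) (a′ ⊗ b)
componentStep-⊗ˡ {b = b} (componentStep {rest = rest} split reduces result) =
  componentStep (++⁺ʳ (toList (components b)) split) reduces
    (⇄*-pair result (⨂-components b) ◅◅ ⇄*-sym (⊗⋯-++ _ rest (components b)))

componentStep-⊗ʳ : ∀ {a b b′} → ComponentStep b b′ → ComponentStep (a ⊗ b) (a ⊗ b′)
componentStep-⊗ʳ step = componentStep-resp (base comm ◅ ε) (base comm ◅ ε) (componentStep-⊗ˡ step)

componentStep-lam : ∀ {x b b′} → ComponentStep b b′ → ComponentStep (lam x b) (lam x b′)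
componentStep-lam {x} (componentStep {rest = rest} split reduces result) =
  componentStep (Perm.map⁺ ⇄*-setoid ⇄*-setoid ⇄*-lam split) (⇝-lam reduces)
    (⇄*-lam result ◅◅ ⊗⋯-lam x _ rest)

componentStep-atom : ∀ {s t} → toList (components s) ≡ s ∷ [] → s ⟶ t → ComponentStep s t
componentStep-atom single step = componentStep (↭-reflexive single) (_ , _ , ε , step , ε) ε

-- Every step is a step of one component: η, δ and βπζ only fire on variables
-- and eliminations, which are their own single component.
step-componentStep : ∀ {s t} → s ⟶ t → ComponentStep s t
step-componentStep {var _}   step = componentStep-atom refl step
step-componentStep {_ · _}   step = componentStep-atom refl step
step-componentStep {π _ _}   step = componentStep-atom refl step
step-componentStep {_ ⊗ _}   (⟶-↪ (↪-pairˡ step)) = componentStep-⊗ˡ (step-componentStep step)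
step-componentStep {_ ⊗ _}   (⟶-↪ (↪-pairʳ step)) = componentStep-⊗ʳ (step-componentStep step)
step-componentStep {lam _ _} (⟶-↪ (↪-lam step))   = componentStep-lam (step-componentStep step)
step-componentStep {_ ⊗ _}   (⟶-ηδ (η _ (is-elim ()) _ _))
step-componentStep {_ ⊗ _}   (⟶-ηδ (δ _ (is-elim ())))
step-componentStep {_ ⊗ _}   (⟶-↪ (↪-βπζ ()))
step-componentStep {lam _ _} (⟶-ηδ (η _ (is-elim ()) _ _))
step-componentStep {lam _ _} (⟶-ηδ (δ _ (is-elim ())))
step-componentStep {lam _ _} (⟶-↪ (↪-βπζ ()))

extract : ∀ {c xs} → Any (c ⇄*_) xs → ∃[ N ] (xs ↭ c ∷ N)
extract {xs = _ ∷ xs} (here c⇄x) = xs , prep (⇄*-sym c⇄x) ↭-refl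
extract (there {x} p) =
  let N , xs↭ = extract p in x ∷ N , ↭-trans (↭-prep x xs↭) (↭-swap x _ ↭-refl)

⇝-component : ∀ {p c c′ N} → toList (components p) ↭ c ∷ N → c ⇝ c′ → p ⇝ c′ ⊗⋯ N
⇝-component {p} {N = N} split (c₀ , c₁ , c⇄c₀ , step , c₁⇄c′) =
  c₀ ⊗⋯ N , c₁ ⊗⋯ N ,
  ⨂-components p ◅◅ ⊗⋯-↭ split ◅◅ ⊗⋯-head N c⇄c₀ ,
  ⊗⋯-step N step ,
  ⊗⋯-head N c₁⇄c′

⊗⋯-regroup : ∀ {p q c c′ N M} → toList (components p) ↭ c ∷ N
  → toList (components (p ⊗ q)) ↭ c ∷ M → c′ ⊗⋯ M ⇄* (c′ ⊗⋯ N) ⊗ q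
⊗⋯-regroup {p} {q} {c′ = c′} {N} p-split pq-split =
  ⊗⋯-↭ (prep ε (↭-sym rest↭)) ◅◅ ⊗⋯-++ c′ N (components q) ◅◅ ⇄*-pair ε (⇄*-sym (⨂-components q))
  where
  rest↭ : N ++ toList (components q) ↭ _
  rest↭ = drop-∷ (↭-trans (↭-sym (++⁺ʳ (toList (components q)) p-split)) pq-split)

componentStep-left : ∀ {p q t} (step : ComponentStep (p ⊗ q) t)
  → Any (ComponentStep.c step ⇄*_) (toList (components p)) → ∃[ u ] (t ⇄* u ⊗ q × p ⇝ u)
componentStep-left {p} {q} (componentStep split reduces result) in-p =
  let _ , p-split = extract in-p
  in _ , result ◅◅ ⊗⋯-regroup {p} {q} p-split split , ⇝-component {p} p-split reduces

componentStep-⊗ : ∀ {p q t} → ComponentStep (p ⊗ q) t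
  → (∃[ u ] (t ⇄* u ⊗ q × p ⇝ u)) ⊎ (∃[ u ] (t ⇄* p ⊗ u × q ⇝ u))
componentStep-⊗ {p} step with Any.++⁻ (toList (components p)) (componentStep-occurs step)
... | inj₁ in-p = inj₁ (componentStep-left step in-p)
... | inj₂ in-q =
  let u , t⇄ , q⇝u = componentStep-left (componentStep-resp (base comm ◅ ε) ε step) in-q
  in inj₂ (u , t⇄ ◅◅ (base comm ◅ ε) , q⇝u)

-- The main theorem.
mainTheorem11 : ∀ (r₁ r₂ s t : Tm) → IsTerm (r₁ ⊗ r₂)
    → (r₁ ⊗ r₂) ⇄* s → s ⟶ t
    → ∃[ u₁ ] ∃[ u₂ ] (t ⇄* (u₁ ⊗ u₂)
        × ((r₁ ⇝ u₁ × r₂ ⇄* u₂) ⊎ (r₁ ⇄* u₁ × r₂ ⇝ u₂)))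
mainTheorem11 r₁ r₂ s t _ r⇄s s⟶t
  with componentStep-⊗ (componentStep-resp r⇄s ε (step-componentStep s⟶t))
... | inj₁ (u , t⇄ , r₁⇝u) = u , r₂ , t⇄ , inj₁ (r₁⇝u , ε)
... | inj₂ (u , t⇄ , r₂⇝u) = r₁ , u , t⇄ , inj₂ (ε , r₂⇝u)
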